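{- Let $k\geqslant1$, $t\ge0$, $n\geqslant1$, $0\leqslant r\leqslant kt$, and let $a_0,\dots,a_t,x$ be independent variables. Then \[ \operatorname{Tr}\Bigl(\bigl(\Pi_{r,t}^{[k]}(a_0,a_1x,a_2x^2,\dots,a_tx^t)\bigr)^n\Bigr)=x^{rn}\operatorname{Tr}\Bigl(\bigl(\Pi_{r,t}^{[k]}(a_0,a_1,\dots,a_t)\bigr)^n\Bigr). \]
   Context: $i^{\langle l\rangle}$ denotes $i$ repeated $l$ times; $G_{r,t}^{[k]}=\{(1^{\langle l_1\rangle},\dots,t^{\langle l_t\rangle}):0\le l_i\le k,\ \sum l_i=r\}$. The matrix $\Pi_{r,t}^{[k]}(a_0,\dots,a_t)$ is indexed by $G_{r,t}^{[k]}$: $\Pi_{0,0}^{[k]}=k!a_0^k$; for $t\ge1$ and $\overline\alpha=(1^{\langle l_1\rangle},\dots,t^{\langle l_t\rangle})\in G_{r,t}^{[k]}$, entry $(\overline\alpha,\overline\beta)$ is $k!\binom{k}{l_t+\sum_{i=1}^{t-1}p_i}\prod_{i=1}^{t-1}\binom{l_i}{p_i}\,a_0^{k-l_t-\sum p_i}a_1^{p_1}\cdots a_{t-1}^{p_{t-1}}a_t^{l_t}$ if $\overline\beta=(1^{\langle l_t+\sum_{i=1}^{t-1}p_i\rangle},2^{\langle l_1-p_1\rangle},\dots,t^{\langle l_{t-1}-p_{t-1}\rangle})$ with integers $0\le p_i\le l_i$ and $\sum p_i\le k-l_t$; $0$ otherwise. -}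

module Defs where

open import Level using (Level)
open import Algebra.Bundles using (CommutativeRing)
open import Data.Nat as ℕ using (ℕ; zero; suc; _∸_; _≤?_; _!)
open import Data.Nat.Combinatorics using (_C_)
open import Data.List as L using (List; []; _∷_; upTo; concatMap; filter)
open import Data.Vec as V using (Vec; []; _∷_; init; last; lookup; tabulate; zipWith)
open import Data.Vec.Properties using (≡-dec)
open import Data.Fin using (toℕ)
open import Relation.Nullary using (yes; no)
open import Relation.Binary.PropositionalEquality using (_≡_)

vsum : ∀ {m} → Vec ℕ m → ℕ
vsum = V.foldr _ ℕ._+_ 0

_≟v_ : ∀ {m} → (u v : Vec ℕ m) → Relation.Nullary.Dec (u ≡ v)
_≟v_ = ≡-dec ℕ._≟_

box : ∀ {m} → Vec ℕ m → List (Vec ℕ m)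
box [] = [] ∷ []
box (l ∷ ls) = concatMap (λ p → L.map (p ∷_) (box ls)) (upTo (suc l))

cube : (t k : ℕ) → List (Vec ℕ t)
cube t k = box (V.replicate t k)

-- G_{r,t}^{[k]}: the tuple (1^⟨l_1⟩,…,t^⟨l_t⟩) is encoded by (l_1,…,l_t)
G : (r t k : ℕ) → List (Vec ℕ t)
G r t k = filter (λ l → vsum l ℕ.≟ r) (cube t k)

module _ {c ℓ : Level} (R : CommutativeRing c ℓ) where
  open CommutativeRing R

  fromℕ : ℕ → Carrier
  fromℕ zero = 0#
  fromℕ (suc n) = 1# + fromℕ n

  pow : Carrier → ℕ → Carrier
  pow y zero = 1#
  pow y (suc n) = y * pow y n

  Σl : ∀ {A : Set} → List A → (A → Carrier) → Carrier
  Σl xs f = L.foldr (λ u acc → f u + acc) 0# xs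

  Πv : ∀ {m} → Vec Carrier m → Carrier
  Πv = V.foldr _ _*_ 1#

  ΠEntry : (k t : ℕ) → Vec Carrier (suc t) → Vec ℕ t → Vec ℕ t → Carrier
  ΠEntry k zero (a₀ ∷ []) α β = fromℕ (k !) * pow a₀ k
  ΠEntry k (suc s) (a₀ ∷ as) α β =
      Σl (filter (λ p → vsum p ≤? (k ∸ lt)) (box ls)) term
    where
      ls : Vec ℕ s
      ls = init α
      lt : ℕ
      lt = last α
      am : Vec Carrier s
      am = init as
      at : Carrier
      at = last as
      target : Vec ℕ s → Vec ℕ (suc s)
      target p = (lt ℕ.+ vsum p) ∷ zipWith _∸_ ls p
      value : Vec ℕ s → Carrier
      value p = fromℕ ((k !) ℕ.* (k C (lt ℕ.+ vsum p))
                         ℕ.* V.foldr _ ℕ._*_ 1 (zipWith _C_ ls p))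
              * pow a₀ (k ∸ (lt ℕ.+ vsum p))
              * Πv (zipWith pow am p)
              * pow at lt
      term : Vec ℕ s → Carrier
      term p with β ≟v target p
      ... | yes _ = value p
      ... | no _ = 0#

  -- Matrices indexed by an (duplicate-free) index list I
  Mat : ℕ → Set c
  Mat t = Vec ℕ t → Vec ℕ t → Carrier

  matMul : ∀ {t} → List (Vec ℕ t) → Mat t → Mat t → Mat t
  matMul I A B α γ = Σl I (λ β → A α β * B β γ)

  matId : ∀ {t} → Mat t
  matId α β with α ≟v β
  ... | yes _ = 1#
  ... | no _ = 0#

  matPow : ∀ {t} → List (Vec ℕ t) → Mat t → ℕ → Mat t
  matPow I A zero = matId
  matPow I A (suc n) = matMul I A (matPow I A n)

  trace : ∀ {t} → List (Vec ℕ t) → Mat t → Carrier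
  trace I M = Σl I (λ α → M α α)

  TrΠpow : (r t k : ℕ) → Vec Carrier (suc t) → ℕ → Carrier
  TrΠpow r t k a n = trace (G r t k) (matPow (G r t k) (ΠEntry k t a) n)

  scaled : ∀ {t} → Vec Carrier (suc t) → Carrier → Vec Carrier (suc t)
  scaled a x = tabulate (λ i → lookup a i * pow x (toℕ i))

module Submission where

-- Give the index tuple α = (1^⟨l₁⟩,…,t^⟨l_t⟩), encoded by
-- (l₁,…,l_t), the weight w(α) = Σᵢ i·lᵢ (the sum of the entries of the tuple).
-- Substituting a_i ↦ a_i xⁱ multiplies the (α,β) entry of Π = Π_{r,t}^{[k]} by
-- x^(r + w(α) − w(β)); moreover the entry vanishes when r + w(α) < w(β), so this
-- exponent is a genuine natural number.  (For the summand indexed by p the column is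
-- β = (1^⟨l_t+Σp⟩, 2^⟨l₁−p₁⟩, …), and the summand picks up x^(Σ i·pᵢ + t·l_t), which is
-- exactly r + w(α) − w(β).)  We call such a pair of matrices *graded* of degree r.
-- Graded pairs are closed under products (degrees add), so Πⁿ with the substitution is
-- graded of degree n·r over Πⁿ; on the diagonal the weights cancel and the trace is
-- multiplied by x^(n·r).

module Weights where

  open import Data.Nat using (ℕ; suc; _+_; _*_; _∸_; _≤_)
  open import Data.Nat.Properties
  open import Data.Nat.Tactic.RingSolver using (solve-∀)
  open import Data.List.Relation.Unary.All as All using (All; []; _∷_)
  import Data.List.Relation.Unary.All.Properties as All
  open import Data.Vec using (Vec; []; _∷_; _∷ʳ_; init; last; initLast; zipWith)
  open import Data.Vec.Relation.Binary.Pointwise.Inductive using (Pointwise; []; _∷_)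
  open import Data.Product using (proj₂)
  open import Function.Base using (id)
  open import Relation.Binary.PropositionalEquality
  open ≡-Reasoning
  open import Defs using (vsum; box)

  weight : ∀ {n} → ℕ → Vec ℕ n → ℕ
  weight m [] = 0
  weight m (l ∷ ls) = m * l + weight (suc m) ls

  _≤ᵛ_ : ∀ {n} → Vec ℕ n → Vec ℕ n → Set
  _≤ᵛ_ = Pointwise _≤_

  box-bounded : ∀ {n} (l : Vec ℕ n) → All (_≤ᵛ l) (box l)
  box-bounded [] = [] ∷ []
  box-bounded (l ∷ ls) =
    All.concat⁺ (All.map⁺ (All.applyUpTo⁺₁ id (suc l) (λ i<1+l →
      All.map⁺ (All.map (≤-pred i<1+l ∷_) (box-bounded ls)))))

  weight-suc : ∀ {n} m (v : Vec ℕ n) → weight (suc m) v ≡ weight m v + vsum v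
  weight-suc m [] = refl
  weight-suc m (l ∷ ls) rewrite weight-suc (suc m) ls | weight-suc m ls =
    regroup (m * l) (weight m ls) (vsum ls) l
    where
    regroup : ∀ a b c l → l + a + (b + c + c) ≡ a + (b + c) + (l + c)
    regroup = solve-∀

  weight-∷ʳ : ∀ {n} m (u : Vec ℕ n) z → weight m (u ∷ʳ z) ≡ weight m u + (m + n) * z
  weight-∷ʳ m [] z rewrite +-identityʳ m = +-identityʳ (m * z)
  weight-∷ʳ {suc n} m (l ∷ u) z rewrite weight-∷ʳ (suc m) u z | +-suc m n =
    sym (+-assoc (m * l) (weight (suc m) u) _)

  vsum-∷ʳ : ∀ {n} (u : Vec ℕ n) z → vsum (u ∷ʳ z) ≡ vsum u + z
  vsum-∷ʳ [] z = +-identityʳ z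
  vsum-∷ʳ (l ∷ u) z rewrite vsum-∷ʳ u z = sym (+-assoc l (vsum u) z)

  private
    interchange : ∀ a b c d → a + b + (c + d) ≡ (a + c) + (b + d)
    interchange = solve-∀

  weight-split : ∀ {n} m {p l : Vec ℕ n} → p ≤ᵛ l →
    weight m p + weight m (zipWith _∸_ l p) ≡ weight m l
  weight-split m [] = refl
  weight-split m {q ∷ p} {l ∷ ls} (q≤l ∷ p≤ls) = begin
      m * q + weight (suc m) p + (m * (l ∸ q) + weight (suc m) (zipWith _∸_ ls p))
    ≡⟨ interchange (m * q) _ (m * (l ∸ q)) _ ⟩
      (m * q + m * (l ∸ q)) + (weight (suc m) p + weight (suc m) (zipWith _∸_ ls p))
    ≡⟨ cong₂ _+_ (trans (sym (*-distribˡ-+ m q (l ∸ q))) (cong (m *_) (m+[n∸m]≡n q≤l)))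
                 (weight-split (suc m) p≤ls) ⟩
      m * l + weight (suc m) ls ∎

  vsum-split : ∀ {n} {p l : Vec ℕ n} → p ≤ᵛ l → vsum p + vsum (zipWith _∸_ l p) ≡ vsum l
  vsum-split [] = refl
  vsum-split {p = q ∷ p} {l ∷ ls} (q≤l ∷ p≤ls) = begin
      q + vsum p + ((l ∸ q) + vsum (zipWith _∸_ ls p))
    ≡⟨ interchange q (vsum p) (l ∸ q) _ ⟩
      (q + (l ∸ q)) + (vsum p + vsum (zipWith _∸_ ls p))
    ≡⟨ cong₂ _+_ (m+[n∸m]≡n q≤l) (vsum-split p≤ls) ⟩
      l + vsum ls ∎

  -- The column in which the summand indexed by p of row α sits:
  -- (1^⟨l_t + Σp⟩, 2^⟨l₁ − p₁⟩, …, t^⟨l_{t−1} − p_{t−1}⟩).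
  column : ∀ {s} → Vec ℕ (suc s) → Vec ℕ s → Vec ℕ (suc s)
  column α p = (last α + vsum p) ∷ zipWith _∸_ (init α) p

  init-∷ʳ-last : ∀ {a} {A : Set a} {s} (v : Vec A (suc s)) → v ≡ init v ∷ʳ last v
  init-∷ʳ-last v = proj₂ (proj₂ (initLast v))

  weight-column : ∀ {s} (α : Vec ℕ (suc s)) {p} → p ≤ᵛ init α →
    weight 1 p + suc s * last α + weight 1 (column α p) ≡ weight 1 α + vsum α
  weight-column {s} α {p} p≤ = begin
      weight 1 p + suc s * lt + (1 * (lt + vsum p) + weight 2 d)
    ≡⟨ cong (λ e → weight 1 p + suc s * lt + (1 * (lt + vsum p) + e)) (weight-suc 1 d) ⟩
      weight 1 p + suc s * lt + (1 * (lt + vsum p) + (weight 1 d + vsum d))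
    ≡⟨ regroup (weight 1 p) (weight 1 d) (vsum p) (vsum d) (suc s * lt) lt ⟩
      (weight 1 p + weight 1 d + suc s * lt) + (vsum p + vsum d + lt)
    ≡⟨ cong₂ (λ a b → a + suc s * lt + (b + lt)) (weight-split 1 p≤) (vsum-split p≤) ⟩
      (weight 1 ls + suc s * lt) + (vsum ls + lt)
    ≡⟨ sym (cong₂ _+_ (weight-∷ʳ 1 ls lt) (vsum-∷ʳ ls lt)) ⟩
      weight 1 (ls ∷ʳ lt) + vsum (ls ∷ʳ lt)
    ≡⟨ cong (λ v → weight 1 v + vsum v) (sym (init-∷ʳ-last α)) ⟩
      weight 1 α + vsum α ∎
    where
    ls = init α
    lt = last α
    d = zipWith _∸_ ls p
    regroup : ∀ wp wd sp sd S l →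
      wp + S + (1 * (l + sp) + (wd + sd)) ≡ (wp + wd + S) + (sp + sd + l)
    regroup = solve-∀

  ∸-telescope : ∀ {d m e n} → m ≤ d → n ≤ m + e → d ∸ m + (m + e ∸ n) ≡ d + e ∸ n
  ∸-telescope {d} {m} {e} {n} m≤d n≤m+e = begin
      d ∸ m + (m + e ∸ n)    ≡⟨ sym (+-∸-assoc (d ∸ m) n≤m+e) ⟩
      d ∸ m + (m + e) ∸ n    ≡⟨ cong (_∸ n) (sym (+-assoc (d ∸ m) m e)) ⟩
      d ∸ m + m + e ∸ n      ≡⟨ cong (λ j → j + e ∸ n) (m∸n+n≡m m≤d) ⟩
      d + e ∸ n ∎

open import Algebra.Bundles using (CommutativeRing)

module Scaling {c ℓ} (R : CommutativeRing c ℓ) (x : CommutativeRing.Carrier R) where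

  open import Data.Nat as ℕ using (ℕ; zero; suc; _∸_; _≤?_; _!)
  import Data.Nat.Properties as ℕ
  open import Data.Nat.Combinatorics using (_C_)
  open import Data.List as List using (List; []; _∷_)
  open import Data.List.Relation.Unary.All as All using (All; []; _∷_)
  import Data.List.Relation.Unary.All.Properties as All
  open import Data.Vec as Vec using (Vec; []; _∷_; _∷ʳ_; init; last; tail; lookup; tabulate; zipWith)
  open import Data.Vec.Properties using (init-∷ʳ; last-∷ʳ; tabulate-cong)
  open import Data.Fin using (toℕ)
  open import Data.Empty using (⊥-elim)
  open import Relation.Nullary using (yes; no)
  open import Relation.Binary.PropositionalEquality as ≡ using (_≡_)
  open import Defs
  open Weights

  open CommutativeRing R
  open import Algebra.Properties.CommutativeSemigroup *-commutativeSemigroup using (interchange)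
  open import Algebra.Properties.Semiring.Exp semiring
    using (^-congˡ; ^-homo-*; ^-assocʳ) renaming (_^_ to _^ᴹ_)
  open import Algebra.Properties.CommutativeSemiring.Exp commutativeSemiring using (^-distrib-*)
  open import Algebra.Solver.CommutativeMonoid *-commutativeMonoid using (solve; _⊜_; _⊕_)
  open import Relation.Binary.Reasoning.Setoid setoid

  infixr 8 _^_
  _^_ : Carrier → ℕ → Carrier
  _^_ = pow R

  -- `pow` coincides with the library's monoid exponentiation, whose laws we reuse.
  pow≡^ᴹ : ∀ y n → y ^ n ≡ y ^ᴹ n
  pow≡^ᴹ y zero = ≡.refl
  pow≡^ᴹ y (suc n) = ≡.cong (y *_) (pow≡^ᴹ y n)

  pow-cong : ∀ {y z} n → y ≈ z → y ^ n ≈ z ^ n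
  pow-cong {y} {z} n y≈z rewrite pow≡^ᴹ y n | pow≡^ᴹ z n = ^-congˡ n y≈z

  pow-+ : ∀ y m n → y ^ (m ℕ.+ n) ≈ y ^ m * y ^ n
  pow-+ y m n rewrite pow≡^ᴹ y (m ℕ.+ n) | pow≡^ᴹ y m | pow≡^ᴹ y n = ^-homo-* y m n

  pow-* : ∀ y z n → (y * z) ^ n ≈ y ^ n * z ^ n
  pow-* y z n rewrite pow≡^ᴹ (y * z) n | pow≡^ᴹ y n | pow≡^ᴹ z n = ^-distrib-* y z n

  pow-pow : ∀ y m n → (y ^ m) ^ n ≈ y ^ (m ℕ.* n)
  pow-pow y m n rewrite pow≡^ᴹ (y ^ m) n | pow≡^ᴹ y m | pow≡^ᴹ y (m ℕ.* n) = ^-assocʳ y m n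

  -- `Shifted d m u v`: v = x^(d − m) · u, where u = 0 whenever d < m, so that the
  -- truncated exponent d ∸ m loses no information.
  record Shifted (d m : ℕ) (u v : Carrier) : Set ℓ where
    constructor shifted
    field
      scale  : v ≈ x ^ (d ∸ m) * u
      vanish : d ℕ.< m → u ≈ 0#
  open Shifted

  shifted-exact : ∀ {c d m u v} → c ℕ.+ m ≡ d → v ≈ x ^ c * u → Shifted d m u v
  shifted-exact {c} {m = m} ≡.refl v≈ =
    shifted (trans v≈ (reflexive (≡.cong (λ e → x ^ e * _) (≡.sym (ℕ.m+n∸n≡m c m)))))
            (λ c+m<m → ⊥-elim (ℕ.<⇒≱ c+m<m (ℕ.m≤n+m m c)))

  shifted-null : ∀ {d m u v} → u ≈ 0# → v ≈ 0# → Shifted d m u v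
  shifted-null u≈0 v≈0 = shifted (trans v≈0 (sym (trans (*-congˡ u≈0) (zeroʳ _)))) (λ _ → u≈0)

  vanish-scaled : ∀ {d m u v} → Shifted d m u v → d ℕ.< m → v ≈ 0#
  vanish-scaled s d<m = trans (scale s) (trans (*-congˡ (vanish s d<m)) (zeroʳ _))

  shifted-+ : ∀ {d m u v u′ v′} → Shifted d m u v → Shifted d m u′ v′ →
    Shifted d m (u + u′) (v + v′)
  shifted-+ s s′ =
    shifted (trans (+-cong (scale s) (scale s′)) (sym (distribˡ _ _ _)))
            (λ d<m → trans (+-cong (vanish s d<m) (vanish s′ d<m)) (+-identityˡ 0#))

  shifted-sum : ∀ {A : Set} {d m} (xs : List A) {f g : A → Carrier} →
    All (λ i → Shifted d m (f i) (g i)) xs → Shifted d m (Σl R xs f) (Σl R xs g)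
  shifted-sum [] [] = shifted-null refl refl
  shifted-sum (_ ∷ xs) (s ∷ ss) = shifted-+ s (shifted-sum xs ss)

  shifted-* : ∀ {d m e n u v u′ v′} → Shifted d m u v → Shifted (m ℕ.+ e) n u′ v′ →
    Shifted (d ℕ.+ e) n (u * u′) (v * v′)
  shifted-* {d} {m} {e} {n} {u} {v} {u′} {v′} s s′ with m ℕ.≤? d | n ℕ.≤? m ℕ.+ e
  ... | no m≰d | _ = shifted-null (trans (*-congʳ (vanish s d<m)) (zeroˡ _))
                                  (trans (*-congʳ (vanish-scaled s d<m)) (zeroˡ _))
    where d<m = ℕ.≰⇒> m≰d
  ... | yes _ | no n≰m+e = shifted-null (trans (*-congˡ (vanish s′ m+e<n)) (zeroʳ _))
                                        (trans (*-congˡ (vanish-scaled s′ m+e<n)) (zeroʳ _))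
    where m+e<n = ℕ.≰⇒> n≰m+e
  ... | yes m≤d | yes n≤m+e = shifted scale-* (λ d+e<n → ⊥-elim (ℕ.<⇒≱ d+e<n n≤d+e))
    where
    n≤d+e = ℕ.≤-trans n≤m+e (ℕ.+-monoˡ-≤ e m≤d)
    scale-* : v * v′ ≈ x ^ (d ℕ.+ e ∸ n) * (u * u′)
    scale-* = begin
      v * v′                                        ≈⟨ *-cong (scale s) (scale s′) ⟩
      (x ^ (d ∸ m) * u) * (x ^ (m ℕ.+ e ∸ n) * u′)  ≈⟨ interchange _ _ _ _ ⟩
      (x ^ (d ∸ m) * x ^ (m ℕ.+ e ∸ n)) * (u * u′)  ≈⟨ *-congʳ (sym (pow-+ x (d ∸ m) _)) ⟩
      x ^ (d ∸ m ℕ.+ (m ℕ.+ e ∸ n)) * (u * u′)      ≡⟨ ≡.cong (λ j → x ^ j * (u * u′))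
                                                               (∸-telescope m≤d n≤m+e) ⟩
      x ^ (d ℕ.+ e ∸ n) * (u * u′)                  ∎

  shifted-cancel : ∀ {m e u v} → Shifted (m ℕ.+ e) m u v → Shifted e 0 u v
  shifted-cancel {m} {e} s =
    shifted (trans (scale s) (reflexive (≡.cong (λ j → x ^ j * _) (ℕ.m+n∸m≡n m e)))) (λ ())

  Graded : ∀ {t} (Q : Vec ℕ t → Set) (w : Vec ℕ t → ℕ) (d : ℕ) (A B : Mat R t) → Set ℓ
  Graded Q w d A B = ∀ {α} → Q α → ∀ β → Shifted (w α ℕ.+ d) (w β) (A α β) (B α β)

  module _ {t} {Q : Vec ℕ t → Set} {w : Vec ℕ t → ℕ} where

    graded-id : Graded Q w 0 (matId R) (matId R)
    graded-id {α} _ β with α ≟v β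
    ... | yes ≡.refl = shifted-exact (ℕ.+-comm 0 (w α)) (sym (*-identityˡ 1#))
    ... | no _ = shifted-null refl refl

    module _ {I : List (Vec ℕ t)} (all-Q : All Q I) where

      graded-* : ∀ {d e A B A′ B′} → Graded Q w d A B → Graded Q w e A′ B′ →
        Graded Q w (d ℕ.+ e) (matMul R I A A′) (matMul R I B B′)
      graded-* {d} {e} {A} {B} {A′} {B′} g g′ {α} qα γ =
        ≡.subst (λ j → Shifted j (w γ) (matMul R I A A′ α γ) (matMul R I B B′ α γ))
                (ℕ.+-assoc (w α) d e)
          (shifted-sum I (All.map (λ {β} qβ → shifted-* (g qα β) (g′ qβ γ)) all-Q))

      graded-pow : ∀ {d A B} n → Graded Q w d A B →
        Graded Q w (n ℕ.* d) (matPow R I A n) (matPow R I B n)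
      graded-pow zero g = graded-id
      graded-pow (suc n) g = graded-* g (graded-pow n g)

      -- On the diagonal the weights cancel.
      graded-trace : ∀ {d A B} → Graded Q w d A B → trace R I B ≈ x ^ d * trace R I A
      graded-trace g = scale (shifted-sum I (All.map (λ {α} qα → shifted-cancel (g qα α)) all-Q))

  scaledFrom : ∀ {n} → ℕ → Vec Carrier n → Vec Carrier n
  scaledFrom m [] = []
  scaledFrom m (a ∷ as) = a * x ^ m ∷ scaledFrom (suc m) as

  tabulate-scaledFrom : ∀ {n} m (v : Vec Carrier n) →
    tabulate (λ i → lookup v i * x ^ (m ℕ.+ toℕ i)) ≡ scaledFrom m v
  tabulate-scaledFrom m [] = ≡.refl
  tabulate-scaledFrom m (a ∷ v) = ≡.cong₂ _∷_
    (≡.cong (λ e → a * x ^ e) (ℕ.+-identityʳ m))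
    (≡.trans (tabulate-cong (λ i → ≡.cong (λ e → lookup v i * x ^ e) (ℕ.+-suc m (toℕ i))))
             (tabulate-scaledFrom (suc m) v))

  scaled-tail : ∀ {s} (a₀ : Carrier) (as : Vec Carrier s) →
    tail (scaled R (a₀ ∷ as) x) ≡ scaledFrom 1 as
  scaled-tail a₀ as = tabulate-scaledFrom 1 as

  scaledFrom-∷ʳ : ∀ {n} m (u : Vec Carrier n) z →
    scaledFrom m (u ∷ʳ z) ≡ scaledFrom m u ∷ʳ z * x ^ (m ℕ.+ n)
  scaledFrom-∷ʳ m [] z = ≡.cong (λ e → z * x ^ e ∷ []) (≡.sym (ℕ.+-identityʳ m))
  scaledFrom-∷ʳ {suc n} m (a ∷ u) z = ≡.cong (a * x ^ m ∷_)
    (≡.trans (scaledFrom-∷ʳ (suc m) u z)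
             (≡.cong (λ e → scaledFrom (suc m) u ∷ʳ z * x ^ e) (≡.sym (ℕ.+-suc m n))))

  init-scaledFrom : ∀ {s} m (v : Vec Carrier (suc s)) →
    init (scaledFrom m v) ≡ scaledFrom m (init v)
  init-scaledFrom m v =
    ≡.trans (≡.cong (λ u → init (scaledFrom m u)) (init-∷ʳ-last v))
   (≡.trans (≡.cong init (scaledFrom-∷ʳ m (init v) (last v))) (init-∷ʳ _ _))

  last-scaledFrom : ∀ {s} m (v : Vec Carrier (suc s)) →
    last (scaledFrom m v) ≡ last v * x ^ (m ℕ.+ s)
  last-scaledFrom {s} m v =
    ≡.trans (≡.cong (λ u → last (scaledFrom m u)) (init-∷ʳ-last v))
   (≡.trans (≡.cong last (scaledFrom-∷ʳ m (init v) (last v)))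
            (last-∷ʳ (last v * x ^ (m ℕ.+ s)) (scaledFrom m (init v))))

  Πv-scaledFrom : ∀ {n} m (u : Vec Carrier n) (p : Vec ℕ n) →
    Πv R (zipWith _^_ (scaledFrom m u) p) ≈ x ^ weight m p * Πv R (zipWith _^_ u p)
  Πv-scaledFrom m [] [] = sym (*-identityˡ 1#)
  Πv-scaledFrom m (a ∷ u) (q ∷ p) = begin
      (a * x ^ m) ^ q * Πv R (zipWith _^_ (scaledFrom (suc m) u) p)
    ≈⟨ *-cong (trans (pow-* a (x ^ m) q) (*-congˡ (pow-pow x m q))) (Πv-scaledFrom (suc m) u p) ⟩
      (a ^ q * x ^ (m ℕ.* q)) * (x ^ weight (suc m) p * Πv R (zipWith _^_ u p))
    ≈⟨ trans (*-congʳ (*-comm _ _)) (interchange _ _ _ _) ⟩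
      (x ^ (m ℕ.* q) * x ^ weight (suc m) p) * (a ^ q * Πv R (zipWith _^_ u p))
    ≈⟨ *-congʳ (sym (pow-+ x (m ℕ.* q) (weight (suc m) p))) ⟩
      x ^ (m ℕ.* q ℕ.+ weight (suc m) p) * (a ^ q * Πv R (zipWith _^_ u p)) ∎

  -- For t = s + 1 the entry of Π is by definition a sum over admissible exponent vectors
  -- p; `SumOver` exposes its summand so that it can be reasoned about.
  data SumOver {A : Set} (xs : List A) : Carrier → Set c where
    sumOf : (f : A → Carrier) → SumOver xs (Σl R xs f)

  summand : ∀ {A : Set} {xs : List A} {v} → SumOver xs v → A → Carrier
  summand (sumOf f) = f

  module Entry (k s : ℕ) (a₀ : Carrier) (as : Vec Carrier (suc s)) (α β : Vec ℕ (suc s)) where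

    admissible : List (Vec ℕ s)
    admissible = List.filter (λ p → vsum p ≤? (k ∸ last α)) (box (init α))

    entry-as-sum : SumOver admissible (ΠEntry R k (suc s) (a₀ ∷ as) α β)
    entry-as-sum = sumOf _

    term : Vec ℕ s → Carrier
    term = summand entry-as-sum

    coefficient : Vec ℕ s → Carrier
    coefficient p = fromℕ R ((k !) ℕ.* (k C (last α ℕ.+ vsum p))
                               ℕ.* Vec.foldr _ ℕ._*_ 1 (zipWith _C_ (init α) p))

    value : Vec ℕ s → Carrier
    value p = coefficient p * a₀ ^ (k ∸ (last α ℕ.+ vsum p))
            * Πv R (zipWith _^_ (init as) p) * last as ^ last α

  value-scaling : ∀ {s} (N a₀ : Carrier) (K l : ℕ) (as : Vec Carrier (suc s)) (p : Vec ℕ s) →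
    N * (a₀ * x ^ 0) ^ K * Πv R (zipWith _^_ (init (scaledFrom 1 as)) p) * last (scaledFrom 1 as) ^ l
      ≈ x ^ (weight 1 p ℕ.+ suc s ℕ.* l) * (N * a₀ ^ K * Πv R (zipWith _^_ (init as) p) * last as ^ l)
  value-scaling {s} N a₀ K l as p = begin
      N * (a₀ * x ^ 0) ^ K * Πv R (zipWith _^_ (init (scaledFrom 1 as)) p) * last (scaledFrom 1 as) ^ l
    ≡⟨ ≡.cong₂ (λ v z → N * (a₀ * x ^ 0) ^ K * Πv R (zipWith _^_ v p) * z ^ l)
               (init-scaledFrom 1 as) (last-scaledFrom 1 as) ⟩
      N * (a₀ * x ^ 0) ^ K * Πv R (zipWith _^_ (scaledFrom 1 u) p) * (z * x ^ suc s) ^ l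
    ≈⟨ *-cong (*-cong (*-congˡ (pow-cong K (*-identityʳ a₀))) (Πv-scaledFrom 1 u p))
              (trans (pow-* z _ l) (*-congˡ (pow-pow x (suc s) l))) ⟩
      N * a₀ ^ K * (x ^ weight 1 p * Π) * (z ^ l * x ^ (suc s ℕ.* l))
    ≈⟨ solve 6 (λ N A X P Z Y → ((N ⊕ A) ⊕ (X ⊕ P)) ⊕ (Z ⊕ Y) ⊜ (X ⊕ Y) ⊕ (((N ⊕ A) ⊕ P) ⊕ Z))
             refl N (a₀ ^ K) (x ^ weight 1 p) Π (z ^ l) (x ^ (suc s ℕ.* l)) ⟩
      (x ^ weight 1 p * x ^ (suc s ℕ.* l)) * (N * a₀ ^ K * Π * z ^ l)
    ≈⟨ *-congʳ (sym (pow-+ x (weight 1 p) (suc s ℕ.* l))) ⟩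
      x ^ (weight 1 p ℕ.+ suc s ℕ.* l) * (N * a₀ ^ K * Π * z ^ l) ∎
    where
    u = init as
    z = last as
    Π = Πv R (zipWith _^_ u p)

  module _ (k s : ℕ) (a₀ : Carrier) (as : Vec Carrier (suc s)) (α β : Vec ℕ (suc s)) where
    private
      module E₀ = Entry k s a₀ as α β
      module E₁ = Entry k s (a₀ * x ^ 0) (tail (scaled R (a₀ ∷ as) x)) α β

    term-shifted : ∀ {p} → p ≤ᵛ init α →
      Shifted (weight 1 α ℕ.+ vsum α) (weight 1 β) (E₀.term p) (E₁.term p)
    term-shifted {p} p≤ with β ≟v column α p
    ... | no _ = shifted-null refl refl
    ... | yes β≡ = shifted-exact exponent value≈
      where
      exponent : weight 1 p ℕ.+ suc s ℕ.* last α ℕ.+ weight 1 β ≡ weight 1 α ℕ.+ vsum α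
      exponent = ≡.trans (≡.cong (λ γ → weight 1 p ℕ.+ suc s ℕ.* last α ℕ.+ weight 1 γ) β≡)
                         (weight-column α p≤)
      value≈ : E₁.value p ≈ x ^ (weight 1 p ℕ.+ suc s ℕ.* last α) * E₀.value p
      value≈ = trans (reflexive (≡.cong (λ v → Entry.value k s (a₀ * x ^ 0) v α β p) (scaled-tail a₀ as)))
                     (value-scaling (E₀.coefficient p) a₀ (k ∸ (last α ℕ.+ vsum p)) (last α) as p)

  entry-graded : ∀ k t r (a : Vec Carrier (suc t)) →
    Graded (λ α → vsum α ≡ r) (weight 1) r (ΠEntry R k t a) (ΠEntry R k t (scaled R a x))
  entry-graded k zero r (a₀ ∷ []) {[]} ≡.refl [] =
    shifted-exact ≡.refl (trans (*-congˡ (pow-cong k (*-identityʳ a₀))) (sym (*-identityˡ _)))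
  entry-graded k (suc s) r (a₀ ∷ as) {α} ≡.refl β =
    shifted-sum (Entry.admissible k s a₀ as α β)
      (All.filter⁺ _ (All.map (term-shifted k s a₀ as α β) (box-bounded (init α))))

open import Data.Nat using (ℕ; suc; _≤_; _*_; _≟_)
open import Data.Nat.Properties using (*-comm)
open import Data.Vec using (Vec)
open import Data.List.Relation.Unary.All using (All)
open import Data.List.Relation.Unary.All.Properties using (all-filter)
open import Relation.Binary.PropositionalEquality using (_≡_; cong)
open import Defs

theorem15 : ∀ {c ℓ} (R : CommutativeRing c ℓ) (k t n r : ℕ) →
    1 ≤ k → 1 ≤ n → r ≤ k * t →
    (a : Vec (CommutativeRing.Carrier R) (suc t)) (x : CommutativeRing.Carrier R) →
    CommutativeRing._≈_ R
    (TrΠpow R r t k (scaled R a x) n)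
    (CommutativeRing._*_ R (pow R x (r * n)) (TrΠpow R r t k a n))
-- Π with the substitution is graded of degree r over Π, hence its n-th power of degree
-- n·r, and the trace picks up x^(n·r).
theorem15 R k t n r _ _ _ a x =
  trans (graded-trace rows (graded-pow rows n (entry-graded k t r a)))
        (reflexive (cong (λ e → pow R x e *ᴿ TrΠpow R r t k a n) (*-comm n r)))
  where
  open CommutativeRing R using (trans; reflexive) renaming (_*_ to _*ᴿ_)
  open Scaling R x using (graded-trace; graded-pow; entry-graded)
  rows : All (λ α → vsum α ≡ r) (G r t k)
  rows = all-filter (λ l → vsum l ≟ r) (cube t k)
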